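{- A stable polynomial $f\in\mathbb{C}[X]$ satisfies, for every $n\ge2$ and every $1\le i<n$, \[ f_n(x_1,\dots,x_n)\big|_{x_{i+1}=x_i}=f_{n-2}(x_1,\dots,x_{i-1},x_{i+2},\dots,x_n) \] if and only if $f=F(\mathbb{X})$ for some $F\in\mathit{QSym}$.
   Context: $X=\{x_1,x_2,\dots\}$; a stable polynomial is a sequence $f=(f_n)_{n\ge0}$, $f_n\in\mathbb{C}[x_1,\dots,x_n]$, of bounded total degree, with $f_{n+1}(x_1,\dots,x_n,0)=f_n(x_1,\dots,x_n)$; they form the algebra $\mathbb{C}[X]$. For a composition $I=(i_1,\dots,i_r)$ (sequence of positive integers), $M_I=\sum_{a_1<\dots<a_r}x_{a_1}^{i_1}\cdots x_{a_r}^{i_r}$, $M_{()}=1$, and $\mathit{QSym}$ is the span of the $M_I$. The evaluation on the virtual alphabet $\mathbb{X}=\ominus(x_1)\oplus(x_2)\ominus(x_3)\oplus(x_4)\cdots$ is the linear map $F\mapsto F(\mathbb{X})$ from $\mathit{QSym}$ to $\mathbb{C}[X]$ given on the basis by: $M_I(\mathbb{X})$ is the stable polynomial whose $n$-th component is \[ \sum_{g}\ \prod_{j\ \mathrm{odd}}(-1)^{|g^{ -1}(j)|}\ \prod_{v=1}^r x_{g(v)}^{i_v}, \] the sum running over weakly increasing maps $g:\{1,\dots,r\}\to\{1,\dots,n\}$ such that $|g^{ -1}(j)|\le 1$ for every even $j$. (Equivalently, $F(\mathbb{X})_n=F(\ominus(x_1)\oplus(x_2)\ominus\cdots(x_n))$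 computed with the deconcatenation coproduct of $\mathit{QSym}$ for ordinal sums of alphabets and $G(\ominus Y)=S(G)(Y)$, $S$ the antipode.) -}

module Defs where

open import Level using (Level; _⊔_)
open import Algebra.Bundles using (CommutativeRing)
open import Data.Nat as ℕ using (ℕ; zero; suc)
open import Data.Bool using (Bool; true; false; if_then_else_)
open import Data.List as List using (List; []; _∷_; concatMap; map; foldr; length)
open import Data.Vec as Vec using (Vec; []; _∷_; _∷ʳ_)
open import Data.Vec.Properties using (≡-dec)
import Data.Nat.ListAction as ListAction
open import Data.Product using (_×_; _,_; ∃)
open import Relation.Nullary using (¬_)
open import Relation.Nullary.Decidable using (⌊_⌋)

-- Everything is parametrised by the coefficient ring K (in the paper K = ℂ).
module _ {c ℓ} (K : CommutativeRing c ℓ) where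
  open CommutativeRing K

  natK : ℕ → Carrier
  natK zero    = 0#
  natK (suc n) = 1# + natK n

  record IsChar0Field : Set (c ⊔ ℓ) where
    field
      nontrivial : ¬ (1# ≈ 0#)
      inverse    : ∀ x → ¬ (x ≈ 0#) → ∃ λ y → x * y ≈ 1#
      char0      : ∀ n → ¬ (natK (suc n) ≈ 0#)

  -- A polynomial in x_1..x_n is given by its coefficient function on exponent
  -- vectors e ∈ ℕ^n (entry j ↦ exponent of x_{j+1}), i.e. coefficient of x^e.
  -- A stable polynomial f = (f_n): f_n of uniformly bounded total degree and
  -- f_{n+1}(x_1..x_n,0) = f_n, i.e. coeff_{n+1}(e,0) = coeff_n(e).
  record StablePoly : Set (c ⊔ ℓ) where
    field
      coeff    : (n : ℕ) → Vec ℕ n → Carrier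
      degBound : ℕ
      bounded  : ∀ n (e : Vec ℕ n) → degBound ℕ.< Vec.sum e → coeff n e ≈ 0#
      stable   : ∀ n (e : Vec ℕ n) → coeff (suc n) (e ∷ʳ 0) ≈ coeff n e
  open StablePoly public

  antidiag : (ℕ → ℕ → Carrier) → ℕ → Carrier
  antidiag g zero    = g 0 0
  antidiag g (suc k) = g 0 (suc k) + antidiag (λ a b → g (suc a) b) k

  -- Write n = p + 2 + q, i = p + 1 (so n ≥ 2 and 1 ≤ i < n).
  -- Coefficient of x^α x_i^k x^β (α on x_1..x_{i-1}, β on x_{i+2}..x_n)
  -- in f_n(x_1,..,x_n)|_{x_{i+1}=x_i}:
  substCoeff : StablePoly → ∀ {p q} → Vec ℕ p → ℕ → Vec ℕ q → Carrier
  substCoeff f {p} {q} α k β =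
    antidiag (λ a b → coeff f (p ℕ.+ suc (suc q)) (α Vec.++ (a ∷ b ∷ β))) k

  -- Coefficient of the same monomial in f_{n-2}(x_1..x_{i-1},x_{i+2}..x_n)
  -- (which does not involve x_i):
  dropCoeff : StablePoly → ∀ {p q} → Vec ℕ p → ℕ → Vec ℕ q → Carrier
  dropCoeff f {p} {q} α zero    β = coeff f (p ℕ.+ q) (α Vec.++ β)
  dropCoeff f         α (suc k) β = 0#

  MergeCondition : StablePoly → Set ℓ
  MergeCondition f = ∀ (p q : ℕ) (α : Vec ℕ p) (β : Vec ℕ q) (k : ℕ) →
    substCoeff f α k β ≈ dropCoeff f α k β

  -- Compositions: a list of naturals, entry m encodes the part m+1 (> 0).
  Composition : Set
  Composition = List ℕ

  partSum : Composition → ℕ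
  partSum b = ListAction.sum (map suc b)

  negPow : ℕ → Carrier
  negPow zero    = 1#
  negPow (suc k) = - negPow k

  splits : Composition → List (Composition × Composition)
  splits []       = ([] , []) ∷ []
  splits (x ∷ xs) = ([] , x ∷ xs) ∷ map (λ { (b , r) → (x ∷ b , r) }) (splits xs)

  smallSplits : Composition → List (Composition × Composition)
  smallSplits []       = ([] , []) ∷ []
  smallSplits (x ∷ xs) = ([] , x ∷ xs) ∷ (x ∷ [] , xs) ∷ []

  -- Terms of M_I(𝕏)_n, one per weakly increasing g : {1..r} → {1..n}
  -- with |g⁻¹(j)| ≤ 1 for j even. g is encoded by the consecutive blocks
  -- g⁻¹(1), g⁻¹(2), ... of I; each term is (sign, exponent vector) with sign
  -- ∏_{j odd} (-1)^{|g⁻¹(j)|} and monomial ∏_v x_{g(v)}^{i_v}.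
  -- The Bool says whether the current variable x_j has odd index j.
  terms : (n : ℕ) → Bool → Composition → List (Carrier × Vec ℕ n)
  terms zero    _     []      = (1# , []) ∷ []
  terms zero    _     (_ ∷ _) = []
  terms (suc n) true  I = concatMap
    (λ { (b , r) → map (λ { (s , m) → (negPow (length b) * s , partSum b ∷ m) })
                       (terms n false r) })
    (splits I)
  terms (suc n) false I = concatMap
    (λ { (b , r) → map (λ { (s , m) → (s , partSum b ∷ m) }) (terms n true r) })
    (smallSplits I)

  coeffOf : ∀ {n} → List (Carrier × Vec ℕ n) → Vec ℕ n → Carrier
  coeffOf ts e =
    foldr (λ { (s , m) acc → if ⌊ ≡-dec ℕ._≟_ m e ⌋ then s + acc else acc }) 0# ts

  M𝕏 : Composition → (n : ℕ) → Vec ℕ n → Carrier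
  M𝕏 I n e = coeffOf (terms n true I) e

  -- An element of QSym over K: a finite linear combination Σ a_I M_I.
  QSymElt : Set c
  QSymElt = List (Carrier × Composition)

  eval𝕏 : QSymElt → (n : ℕ) → Vec ℕ n → Carrier
  eval𝕏 F n e = foldr (λ { (a , I) acc → a * M𝕏 I n e + acc }) 0# F

  InImage𝕏 : StablePoly → Set (c ⊔ ℓ)
  InImage𝕏 f = ∃ λ (F : QSymElt) → ∀ n (e : Vec ℕ n) → coeff f n e ≈ eval𝕏 F n e

-- Expanding M_I(𝕏) along its first variable, an odd variable (carrying ⊖) receives any block
-- of consecutive parts of I with sign (-1)^length and an even one (carrying ⊕) at most one
-- part. Setting x_{i+1} = x_i merges two adjacent variables of opposite signs, and the blocks
-- they receive cancel in pairs except when both are empty; this is the merge condition for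
-- every M_I(𝕏), hence for every F(𝕏).
--
-- Conversely, merging (with k = 0) and stability reduce the value of f at any monomial in
-- x₂, x₄, … to its value at some x₂^{i₁} x₄^{i₂} ⋯, where M_J(𝕏) takes the value [I = J]. So
-- f - F(𝕏) vanishes on all such monomials for F = Σ_I f(x₂^{i₁} x₄^{i₂} ⋯) M_I, and a family
-- satisfying the merge condition is determined by these values: at the first nonzero
-- odd exponent, inserting 0, 0 and merging strictly lowers it.

module Submission where

open import Defs
open import Algebra.Bundles using (CommutativeRing)
open import Function.Bundles using (_⇔_; mk⇔)
open import Data.Nat as ℕ using (ℕ; zero; suc; _≡ᵇ_; _<ᵇ_; _≤_; _<_; z≤n; s≤s)
import Data.Nat.Properties as ℕₚ
open import Data.Nat.Induction using (<-rec)
open import Data.Bool using (Bool; true; false; not; if_then_else_; _∧_)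
open import Data.Bool.Properties using (not-involutive)
open import Data.List as List using (List; []; _∷_; _++_; length; map; concatMap; downFrom)
import Data.List.Properties as Listₚ
open import Data.Vec as Vec using (Vec; []; _∷_)
open import Data.Vec.Properties using (≡-dec; toList-++; toList∘fromList; toList-∷ʳ)
open import Data.Product using (_×_; _,_; proj₁; proj₂)
open import Relation.Binary.PropositionalEquality as ≡ using (_≡_)
open import Relation.Nullary.Decidable using (⌊_⌋; isYes≗does)

module _ {c ℓ} (K : CommutativeRing c ℓ) where
  open CommutativeRing K hiding (zero)
  open import Relation.Binary.Reasoning.Setoid setoid
  open import Algebra.Properties.Ring ring using (-‿distribˡ-*)
  open import Algebra.Properties.AbelianGroup +-abelianGroup
    using (⁻¹-∙-comm; ε⁻¹≈ε; //-rightDividesˡ; //-rightDividesʳ; x∙y⁻¹≈ε⇒x≈y)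
  open import Algebra.Properties.CommutativeSemigroup +-commutativeSemigroup using (interchange)

  ΣL : ∀ {a} {A : Set a} → List A → (A → Carrier) → Carrier
  ΣL []       g = 0#
  ΣL (x ∷ xs) g = g x + ΣL xs g

  infix 5 ΣL
  syntax ΣL L (λ x → e) = ∑[ x ∈ L ] e

  ΣL-cong : ∀ {a} {A : Set a} (L : List A) {g h : A → Carrier} →
    (∀ x → g x ≈ h x) → ΣL L g ≈ ΣL L h
  ΣL-cong []      g≈h = refl
  ΣL-cong (x ∷ L) g≈h = +-cong (g≈h x) (ΣL-cong L g≈h)

  ΣL-zero : ∀ {a} {A : Set a} (L : List A) {g : A → Carrier} → (∀ x → g x ≈ 0#) → ΣL L g ≈ 0#
  ΣL-zero L g≈0 = trans (ΣL-cong L g≈0) (zeros L)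
    where
    zeros : ∀ L → ΣL L (λ _ → 0#) ≈ 0#
    zeros []      = refl
    zeros (_ ∷ L) = trans (+-identityˡ _) (zeros L)

  ΣL-+ : ∀ {a} {A : Set a} (L : List A) (g h : A → Carrier) →
    ∑[ x ∈ L ] (g x + h x) ≈ ΣL L g + ΣL L h
  ΣL-+ []      g h = sym (+-identityˡ 0#)
  ΣL-+ (x ∷ L) g h = trans (+-congˡ (ΣL-+ L g h)) (interchange _ _ _ _)

  ΣL-neg : ∀ {a} {A : Set a} (L : List A) (g : A → Carrier) → ∑[ x ∈ L ] (- g x) ≈ - ΣL L g
  ΣL-neg []      g = sym ε⁻¹≈ε
  ΣL-neg (x ∷ L) g = trans (+-congˡ (ΣL-neg L g)) (⁻¹-∙-comm _ _)

  *-distribˡ-ΣL : ∀ {a} {A : Set a} (L : List A) (w : Carrier) (g : A → Carrier) →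
    w * ΣL L g ≈ ∑[ x ∈ L ] (w * g x)
  *-distribˡ-ΣL []      w g = zeroʳ w
  *-distribˡ-ΣL (x ∷ L) w g = trans (distribˡ w _ _) (+-congˡ (*-distribˡ-ΣL L w g))

  ΣL-map : ∀ {a b} {A : Set a} {B : Set b} (f : A → B) (L : List A) (g : B → Carrier) →
    ΣL (map f L) g ≡ ∑[ x ∈ L ] g (f x)
  ΣL-map f []      g = ≡.refl
  ΣL-map f (x ∷ L) g = ≡.cong (g (f x) +_) (ΣL-map f L g)

  ΣL-++ : ∀ {a} {A : Set a} (xs ys : List A) (g : A → Carrier) →
    ΣL (xs ++ ys) g ≈ ΣL xs g + ΣL ys g
  ΣL-++ []       ys g = sym (+-identityˡ _)
  ΣL-++ (x ∷ xs) ys g = trans (+-congˡ (ΣL-++ xs ys g)) (sym (+-assoc _ _ _))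

  ΣL-concatMap : ∀ {a b} {A : Set a} {B : Set b} (f : A → List B) (L : List A) (g : B → Carrier) →
    ΣL (concatMap f L) g ≈ ∑[ x ∈ L ] ΣL (f x) g
  ΣL-concatMap f []      g = refl
  ΣL-concatMap f (x ∷ L) g = trans (ΣL-++ (f x) _ g) (+-congˡ (ΣL-concatMap f L g))

  select : Bool → Carrier → Carrier
  select b x = if b then x else 0#

  select-cong : ∀ b {x y} → x ≈ y → select b x ≈ select b y
  select-cong true  x≈y = x≈y
  select-cong false x≈y = refl

  select-≡ : ∀ {m n} k x → m ≡ n → select (m ≡ᵇ k) x ≡ select (n ≡ᵇ k) x
  select-≡ k x = ≡.cong (λ m → select (m ≡ᵇ k) x)

  select-zero : ∀ b → select b 0# ≈ 0#
  select-zero true  = refl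
  select-zero false = refl

  select-* : ∀ b w x → select b (w * x) ≈ w * select b x
  select-* true  w x = refl
  select-* false w x = sym (zeroʳ w)

  *-select-1# : ∀ b w → w * select b 1# ≈ select b w
  *-select-1# true  w = *-identityʳ w
  *-select-1# false w = zeroʳ w

  select-neg : ∀ b x → select b (- x) ≈ - select b x
  select-neg true  x = refl
  select-neg false x = sym ε⁻¹≈ε

  select-+ : ∀ b x y → select b x + select b y ≈ select b (x + y)
  select-+ true  x y = refl
  select-+ false x y = +-identityʳ 0#

  select-select : ∀ a b x → select a (select b x) ≈ select (a ∧ b) x
  select-select true  b x = refl
  select-select false b x = refl

  select-comm : ∀ a b x → select a (select b x) ≈ select b (select a x)
  select-comm true  true  x = refl
  select-comm true  false x = refl
  select-comm false true  x = refl
  select-comm false false x = refl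

  select-ΣL : ∀ {a} {A : Set a} b (L : List A) (g : A → Carrier) →
    select b (ΣL L g) ≈ ∑[ x ∈ L ] select b (g x)
  select-ΣL true  L g = refl
  select-ΣL false L g = sym (ΣL-zero L (λ _ → refl))

  antidiag-cong : ∀ {g h : ℕ → ℕ → Carrier} → (∀ a b → g a b ≈ h a b) →
    ∀ k → antidiag K g k ≈ antidiag K h k
  antidiag-cong g≈h zero    = g≈h 0 0
  antidiag-cong g≈h (suc k) = +-cong (g≈h 0 (suc k)) (antidiag-cong (λ a b → g≈h (suc a) b) k)

  antidiag-zero : ∀ {g : ℕ → ℕ → Carrier} → (∀ a b → g a b ≈ 0#) → ∀ k → antidiag K g k ≈ 0#
  antidiag-zero g≈0 zero    = g≈0 0 0
  antidiag-zero g≈0 (suc k) =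
    trans (+-cong (g≈0 0 (suc k)) (antidiag-zero (λ a b → g≈0 (suc a) b) k)) (+-identityˡ 0#)

  antidiag-+ : ∀ (g h : ℕ → ℕ → Carrier) k →
    antidiag K (λ a b → g a b + h a b) k ≈ antidiag K g k + antidiag K h k
  antidiag-+ g h zero    = refl
  antidiag-+ g h (suc k) =
    trans (+-congˡ (antidiag-+ (λ a b → g (suc a) b) (λ a b → h (suc a) b) k)) (interchange _ _ _ _)

  antidiag-neg : ∀ (g : ℕ → ℕ → Carrier) k → antidiag K (λ a b → - g a b) k ≈ - antidiag K g k
  antidiag-neg g zero    = refl
  antidiag-neg g (suc k) = trans (+-congˡ (antidiag-neg (λ a b → g (suc a) b) k)) (⁻¹-∙-comm _ _)

  antidiag-* : ∀ w (g : ℕ → ℕ → Carrier) k → antidiag K (λ a b → w * g a b) k ≈ w * antidiag K g k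
  antidiag-* w g zero    = refl
  antidiag-* w g (suc k) = trans (+-congˡ (antidiag-* w (λ a b → g (suc a) b) k)) (sym (distribˡ w _ _))

  antidiag-select : ∀ v (g : ℕ → ℕ → Carrier) k →
    antidiag K (λ a b → select v (g a b)) k ≈ select v (antidiag K g k)
  antidiag-select true  g k = refl
  antidiag-select false g k = antidiag-zero (λ _ _ → refl) k

  antidiag-ΣL : ∀ {a} {A : Set a} (L : List A) (g : A → ℕ → ℕ → Carrier) k →
    antidiag K (λ a b → ∑[ x ∈ L ] g x a b) k ≈ ∑[ x ∈ L ] antidiag K (g x) k
  antidiag-ΣL []      g k = antidiag-zero (λ _ _ → refl) k
  antidiag-ΣL (x ∷ L) g k = trans (antidiag-+ (g x) _ k) (+-congˡ (antidiag-ΣL L g k))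

  antidiag-point : ∀ u v x k →
    antidiag K (λ a b → select (u ≡ᵇ a) (select (v ≡ᵇ b) x)) k ≈ select (u ℕ.+ v ≡ᵇ k) x
  antidiag-point zero    zero    x zero    = refl
  antidiag-point zero    (suc v) x zero    = refl
  antidiag-point (suc u) v       x zero    = refl
  antidiag-point zero    v       x (suc k) = trans (+-congˡ (antidiag-zero (λ _ _ → refl) k)) (+-identityʳ _)
  antidiag-point (suc u) v       x (suc k) = trans (+-identityˡ _) (antidiag-point u v x k)

  antidiag-last : ∀ m (g : ℕ → ℕ → Carrier) → (∀ a → a < m → g a (m ℕ.∸ a) ≈ 0#) →
    antidiag K g m ≈ g m 0
  antidiag-last zero    g g≈0 = refl
  antidiag-last (suc m) g g≈0 =
    trans (+-cong (g≈0 0 (s≤s z≤n)) (antidiag-last m (λ a b → g (suc a) b) (λ a a<m → g≈0 (suc a) (s≤s a<m))))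
          (+-identityˡ _)

  -- Coefficients of M_I(𝕏)

  SignedMonomial : ℕ → Set c
  SignedMonomial n = Carrier × Vec ℕ n

  coeffOf-++ : ∀ {n} (xs ys : List (SignedMonomial n)) e →
    coeffOf K (xs ++ ys) e ≈ coeffOf K xs e + coeffOf K ys e
  coeffOf-++ []             ys e = sym (+-identityˡ _)
  coeffOf-++ ((s , m) ∷ xs) ys e with ⌊ ≡-dec ℕ._≟_ m e ⌋
  ... | true  = trans (+-congˡ (coeffOf-++ xs ys e)) (sym (+-assoc _ _ _))
  ... | false = coeffOf-++ xs ys e

  coeffOf-concatMap : ∀ {a} {A : Set a} {n} (f : A → List (SignedMonomial n)) (L : List A) e →
    coeffOf K (concatMap f L) e ≈ ∑[ x ∈ L ] coeffOf K (f x) e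
  coeffOf-concatMap f []      e = refl
  coeffOf-concatMap f (x ∷ L) e = trans (coeffOf-++ (f x) _ e) (+-congˡ (coeffOf-concatMap f L e))

  ⌊≡-dec⌋-∷ : ∀ {n} x y (m e : Vec ℕ n) →
    ⌊ ≡-dec ℕ._≟_ (x ∷ m) (y ∷ e) ⌋ ≡ (x ≡ᵇ y) ∧ ⌊ ≡-dec ℕ._≟_ m e ⌋
  ⌊≡-dec⌋-∷ x y m e =
    ≡.trans (isYes≗does _) (≡.cong ((x ≡ᵇ y) ∧_) (≡.sym (isYes≗does (≡-dec ℕ._≟_ m e))))

  coeffOf-prepend : ∀ {n} (σ : Carrier → Carrier) x w → (∀ s → σ s ≈ w * s) →
    ∀ (ts : List (SignedMonomial n)) y e →
    coeffOf K (map (λ t → σ (proj₁ t) , x ∷ proj₂ t) ts) (y ∷ e) ≈ select (x ≡ᵇ y) (w * coeffOf K ts e)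
  coeffOf-prepend σ x w σ≈w* []             y e = sym (trans (select-cong (x ≡ᵇ y) (zeroʳ w)) (select-zero _))
  coeffOf-prepend σ x w σ≈w* ((s , m) ∷ ts) y e
    rewrite ⌊≡-dec⌋-∷ x y m e = step (x ≡ᵇ y) ⌊ ≡-dec ℕ._≟_ m e ⌋ (coeffOf-prepend σ x w σ≈w* ts y e)
    where
    step : ∀ b₁ b₂ {A B} → A ≈ select b₁ (w * B) →
      (if b₁ ∧ b₂ then σ s + A else A) ≈ select b₁ (w * (if b₂ then s + B else B))
    step true  true  A≈ = trans (+-cong (σ≈w* s) A≈) (sym (distribˡ w s _))
    step true  false A≈ = A≈
    step false _     A≈ = A≈

  Split : Set
  Split = Composition K × Composition K

  blocks : Bool → Composition K → List Split
  blocks true  = splits K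
  blocks false = smallSplits K

  blockSum : Split → ℕ
  blockSum s = partSum K (proj₁ s)

  blockSign : Bool → Split → Carrier
  blockSign true  s = negPow K (length (proj₁ s))
  blockSign false s = 1#

  terms-∷ : ∀ odd n I y e → coeffOf K (terms K (suc n) odd I) (y ∷ e) ≈
    ∑[ s ∈ blocks odd I ] select (blockSum s ≡ᵇ y) (blockSign odd s * coeffOf K (terms K n (not odd) (proj₂ s)) e)
  terms-∷ true n I y e = trans (coeffOf-concatMap _ (splits K I) (y ∷ e))
    (ΣL-cong (splits K I) λ s →
      coeffOf-prepend (negPow K (length (proj₁ s)) *_) (blockSum s) _ (λ _ → refl) (terms K n false (proj₂ s)) y e)
  terms-∷ false n I y e = trans (coeffOf-concatMap _ (smallSplits K I) (y ∷ e))
    (ΣL-cong (smallSplits K I) λ s →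
      coeffOf-prepend (λ s → s) (blockSum s) 1# (λ _ → sym (*-identityˡ _)) (terms K n true (proj₂ s)) y e)

  -- The nonempty odd blocks of x ∷ xs are those of xs with x prepended, which flips
  -- their sign; by induction they sum to minus the term whose even block is x.
  odd-even-cancel : ∀ (X : Composition K → Carrier) c I k →
    ∑[ s ∈ splits K I ] blockSign true s * (∑[ t ∈ smallSplits K (proj₂ s) ]
      select (c ℕ.+ (blockSum s ℕ.+ blockSum t) ≡ᵇ k) (blockSign false t * X (proj₂ t)))
    ≈ select (c ≡ᵇ k) (X I)
  odd-even-cancel X c [] k = begin
    1# * (select (c ℕ.+ 0 ≡ᵇ k) (1# * X []) + 0#) + 0# ≈⟨ +-identityʳ _ ⟩
    1# * (select (c ℕ.+ 0 ≡ᵇ k) (1# * X []) + 0#)      ≈⟨ *-identityˡ _ ⟩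
    select (c ℕ.+ 0 ≡ᵇ k) (1# * X []) + 0#             ≈⟨ +-identityʳ _ ⟩
    select (c ℕ.+ 0 ≡ᵇ k) (1# * X [])                  ≈⟨ select-cong (c ℕ.+ 0 ≡ᵇ k) (*-identityˡ _) ⟩
    select (c ℕ.+ 0 ≡ᵇ k) (X [])                       ≡⟨ select-≡ k (X []) (ℕₚ.+-identityʳ c) ⟩
    select (c ≡ᵇ k) (X [])                             ∎
  odd-even-cancel X c (x ∷ xs) k = begin
    1# * (select (c ℕ.+ 0 ≡ᵇ k) (1# * X (x ∷ xs)) + (select (c ℕ.+ (suc x ℕ.+ 0) ≡ᵇ k) (1# * X xs) + 0#))
      + ΣL (map (λ { (b , r) → (x ∷ b , r) }) (splits K xs)) (summand c)
      ≈⟨ +-cong emptyOddBlock (trans (reflexive (ΣL-map _ (splits K xs) (summand c))) nonemptyOddBlocks) ⟩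
    (select (c ≡ᵇ k) (X (x ∷ xs)) + select (c ℕ.+ suc x ≡ᵇ k) (X xs)) + - select (c ℕ.+ suc x ≡ᵇ k) (X xs)
      ≈⟨ //-rightDividesʳ _ _ ⟩
    select (c ≡ᵇ k) (X (x ∷ xs)) ∎
    where
    summand : ℕ → Split → Carrier
    summand c s = blockSign true s * (∑[ t ∈ smallSplits K (proj₂ s) ]
      select (c ℕ.+ (blockSum s ℕ.+ blockSum t) ≡ᵇ k) (blockSign false t * X (proj₂ t)))

    emptyOddBlock :
      1# * (select (c ℕ.+ 0 ≡ᵇ k) (1# * X (x ∷ xs)) + (select (c ℕ.+ (suc x ℕ.+ 0) ≡ᵇ k) (1# * X xs) + 0#))
      ≈ select (c ≡ᵇ k) (X (x ∷ xs)) + select (c ℕ.+ suc x ≡ᵇ k) (X xs)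
    emptyOddBlock = trans (*-identityˡ _) (+-cong
      (trans (select-cong _ (*-identityˡ _)) (reflexive (select-≡ k _ (ℕₚ.+-identityʳ c))))
      (trans (+-identityʳ _) (trans (select-cong _ (*-identityˡ _))
        (reflexive (select-≡ k _ (≡.cong (c ℕ.+_) (ℕₚ.+-identityʳ (suc x))))))))

    shift : ∀ u v → c ℕ.+ ((suc x ℕ.+ u) ℕ.+ v) ≡ (c ℕ.+ suc x) ℕ.+ (u ℕ.+ v)
    shift u v = ≡.trans (≡.cong (c ℕ.+_) (ℕₚ.+-assoc (suc x) u v)) (≡.sym (ℕₚ.+-assoc c (suc x) (u ℕ.+ v)))

    nonemptyOddBlocks :
      ∑[ s ∈ splits K xs ] summand c (x ∷ proj₁ s , proj₂ s) ≈ - select (c ℕ.+ suc x ≡ᵇ k) (X xs)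
    nonemptyOddBlocks = begin
      ∑[ s ∈ splits K xs ] summand c (x ∷ proj₁ s , proj₂ s)
        ≈⟨ ΣL-cong (splits K xs) (λ s → trans (sym (-‿distribˡ-* _ _)) (-‿cong (*-congˡ
             (ΣL-cong (smallSplits K (proj₂ s)) (λ t → reflexive (select-≡ k _ (shift (blockSum s) (blockSum t)))))))) ⟩
      ∑[ s ∈ splits K xs ] (- summand (c ℕ.+ suc x) s)
        ≈⟨ ΣL-neg (splits K xs) (summand (c ℕ.+ suc x)) ⟩
      - ΣL (splits K xs) (summand (c ℕ.+ suc x))
        ≈⟨ -‿cong (odd-even-cancel X (c ℕ.+ suc x) xs k) ⟩
      - select (c ℕ.+ suc x ≡ᵇ k) (X xs) ∎

  -- The even block x cancels against the odd blocks starting with x.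
  even-odd-cancel : ∀ (X : Composition K → Carrier) I k →
    ∑[ s ∈ smallSplits K I ] blockSign false s * (∑[ t ∈ splits K (proj₂ s) ]
      select (blockSum s ℕ.+ blockSum t ≡ᵇ k) (blockSign true t * X (proj₂ t)))
    ≈ select (0 ≡ᵇ k) (X I)
  even-odd-cancel X [] k =
    trans (+-identityʳ _) (trans (*-identityˡ _) (trans (+-identityʳ _) (select-cong (0 ≡ᵇ k) (*-identityˡ _))))
  even-odd-cancel X (x ∷ xs) k = begin
    1# * (select (0 ≡ᵇ k) (1# * X (x ∷ xs)) + ΣL (map (λ { (b , r) → (x ∷ b , r) }) (splits K xs)) (summand 0))
      + (1# * (∑[ t ∈ splits K xs ] summand (suc x ℕ.+ 0) t) + 0#)
      ≈⟨ +-cong (*-congˡ (+-cong (select-cong (0 ≡ᵇ k) (*-identityˡ _))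
                   (trans (reflexive (ΣL-map _ (splits K xs) (summand 0))) oddBlockStartingWithX)))
                evenBlockX ⟩
    1# * (select (0 ≡ᵇ k) (X (x ∷ xs)) + - ΣL (splits K xs) (summand (suc x)))
      + ΣL (splits K xs) (summand (suc x))
      ≈⟨ trans (+-congʳ (*-identityˡ _)) (//-rightDividesˡ _ _) ⟩
    select (0 ≡ᵇ k) (X (x ∷ xs)) ∎
    where
    summand : ℕ → Split → Carrier
    summand u t = select (u ℕ.+ blockSum t ≡ᵇ k) (blockSign true t * X (proj₂ t))

    oddBlockStartingWithX :
      ∑[ t ∈ splits K xs ] summand 0 (x ∷ proj₁ t , proj₂ t) ≈ - ΣL (splits K xs) (summand (suc x))
    oddBlockStartingWithX = trans
      (ΣL-cong (splits K xs) (λ t → trans (select-cong _ (sym (-‿distribˡ-* _ _))) (select-neg _ _)))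
      (ΣL-neg (splits K xs) (summand (suc x)))

    evenBlockX : 1# * (∑[ t ∈ splits K xs ] summand (suc x ℕ.+ 0) t) + 0# ≈ ΣL (splits K xs) (summand (suc x))
    evenBlockX = trans (+-identityʳ _) (trans (*-identityˡ _) (reflexive
      (≡.cong (ΣL (splits K xs)) (≡.cong summand (ℕₚ.+-identityʳ (suc x))))))

  adjacent-blocks-cancel : ∀ odd (X : Composition K → Carrier) I k →
    ∑[ s ∈ blocks odd I ] blockSign odd s * (∑[ t ∈ blocks (not odd) (proj₂ s) ]
      select (blockSum s ℕ.+ blockSum t ≡ᵇ k) (blockSign (not odd) t * X (proj₂ t)))
    ≈ select (0 ≡ᵇ k) (X I)
  adjacent-blocks-cancel true  X = odd-even-cancel X 0
  adjacent-blocks-cancel false X = even-odd-cancel X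

  antidiag-double : ∀ {a b} {A : Set a} {B : Set b} (L : List A) (u : A → ℕ) (σ : A → Carrier)
    (M : A → List B) (v : B → ℕ) (Y : B → Carrier) k →
    antidiag K (λ a b → ∑[ x ∈ L ] select (u x ≡ᵇ a) (σ x * (∑[ y ∈ M x ] select (v y ≡ᵇ b) (Y y)))) k
    ≈ ∑[ x ∈ L ] σ x * (∑[ y ∈ M x ] select (u x ℕ.+ v y ≡ᵇ k) (Y y))
  antidiag-double L u σ M v Y k = begin
    antidiag K (λ a b → ∑[ x ∈ L ] select (u x ≡ᵇ a) (σ x * (∑[ y ∈ M x ] select (v y ≡ᵇ b) (Y y)))) k
      ≈⟨ antidiag-ΣL L _ k ⟩
    ∑[ x ∈ L ] antidiag K (λ a b → select (u x ≡ᵇ a) (σ x * (∑[ y ∈ M x ] select (v y ≡ᵇ b) (Y y)))) k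
      ≈⟨ ΣL-cong L (λ x → antidiag-cong (λ a b →
           trans (select-* (u x ≡ᵇ a) (σ x) _) (*-congˡ (select-ΣL (u x ≡ᵇ a) (M x) _))) k) ⟩
    ∑[ x ∈ L ] antidiag K (λ a b → σ x * (∑[ y ∈ M x ] select (u x ≡ᵇ a) (select (v y ≡ᵇ b) (Y y)))) k
      ≈⟨ ΣL-cong L (λ x → trans (antidiag-* (σ x) _ k) (*-congˡ
           (trans (antidiag-ΣL (M x) _ k) (ΣL-cong (M x) (λ y → antidiag-point (u x) (v y) (Y y) k))))) ⟩
    ∑[ x ∈ L ] σ x * (∑[ y ∈ M x ] select (u x ℕ.+ v y ≡ᵇ k) (Y y)) ∎

  antidiag-under-select : ∀ {a} {A : Set a} (L : List A) (u : A → ℕ) x (σ : A → Carrier)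
    (G : A → ℕ → ℕ → Carrier) (H : A → Carrier) k →
    (∀ y → antidiag K (G y) k ≈ select (0 ≡ᵇ k) (H y)) →
    antidiag K (λ a b → ∑[ y ∈ L ] select (u y ≡ᵇ x) (σ y * G y a b)) k
    ≈ select (0 ≡ᵇ k) (∑[ y ∈ L ] select (u y ≡ᵇ x) (σ y * H y))
  antidiag-under-select L u x σ G H k G≈H = begin
    antidiag K (λ a b → ∑[ y ∈ L ] select (u y ≡ᵇ x) (σ y * G y a b)) k
      ≈⟨ antidiag-ΣL L _ k ⟩
    ∑[ y ∈ L ] antidiag K (λ a b → select (u y ≡ᵇ x) (σ y * G y a b)) k
      ≈⟨ ΣL-cong L (λ y → trans (antidiag-select (u y ≡ᵇ x) _ k)
           (select-cong (u y ≡ᵇ x) (trans (antidiag-* (σ y) (G y) k) (*-congˡ (G≈H y))))) ⟩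
    ∑[ y ∈ L ] select (u y ≡ᵇ x) (σ y * select (0 ≡ᵇ k) (H y))
      ≈⟨ ΣL-cong L (λ y → trans (select-cong (u y ≡ᵇ x) (sym (select-* (0 ≡ᵇ k) (σ y) (H y))))
           (select-comm (u y ≡ᵇ x) (0 ≡ᵇ k) _)) ⟩
    ∑[ y ∈ L ] select (0 ≡ᵇ k) (select (u y ≡ᵇ x) (σ y * H y))
      ≈⟨ sym (select-ΣL (0 ≡ᵇ k) L _) ⟩
    select (0 ≡ᵇ k) (∑[ y ∈ L ] select (u y ≡ᵇ x) (σ y * H y)) ∎

  -- The merge condition for M_I(𝕏) and F(𝕏)

  Family : Set c
  Family = (n : ℕ) → Vec ℕ n → Carrier

  Merges : Family → Set ℓ
  Merges g = ∀ p q (α : Vec ℕ p) (β : Vec ℕ q) k →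
    antidiag K (λ a b → g (p ℕ.+ suc (suc q)) (α Vec.++ (a ∷ b ∷ β))) k
    ≈ select (0 ≡ᵇ k) (g (p ℕ.+ q) (α Vec.++ β))

  terms-merges : ∀ odd I → Merges (λ n → coeffOf K (terms K n odd I))
  terms-merges odd I zero q [] β k = begin
    antidiag K (λ a b → coeffOf K (terms K (suc (suc q)) odd I) (a ∷ b ∷ β)) k
      ≈⟨ antidiag-cong (λ a b → trans (terms-∷ odd (suc q) I a (b ∷ β))
           (ΣL-cong (blocks odd I) (λ s → select-cong _ (*-congˡ (terms-∷ (not odd) q (proj₂ s) b β))))) k ⟩
    _ ≈⟨ antidiag-double (blocks odd I) blockSum (blockSign odd) (λ s → blocks (not odd) (proj₂ s)) blockSum _ k ⟩
    _ ≈⟨ adjacent-blocks-cancel odd (λ R → coeffOf K (terms K q (not (not odd)) R) β) I k ⟩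
    select (0 ≡ᵇ k) (coeffOf K (terms K q (not (not odd)) I) β)
      ≡⟨ ≡.cong (λ b → select (0 ≡ᵇ k) (coeffOf K (terms K q b I) β)) (not-involutive odd) ⟩
    select (0 ≡ᵇ k) (coeffOf K (terms K q odd I) β) ∎
  terms-merges odd I (suc p) q (x ∷ α) β k = begin
    antidiag K (λ a b → coeffOf K (terms K (suc (p ℕ.+ suc (suc q))) odd I) (x ∷ α Vec.++ (a ∷ b ∷ β))) k
      ≈⟨ antidiag-cong (λ a b → terms-∷ odd _ I x _) k ⟩
    _ ≈⟨ antidiag-under-select (blocks odd I) blockSum x (blockSign odd) _ _ k
           (λ s → terms-merges (not odd) (proj₂ s) p q α β k) ⟩
    _ ≈⟨ select-cong (0 ≡ᵇ k) (sym (terms-∷ odd (p ℕ.+ q) I x (α Vec.++ β))) ⟩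
    select (0 ≡ᵇ k) (coeffOf K (terms K (suc (p ℕ.+ q)) odd I) (x ∷ α Vec.++ β)) ∎

  eval𝕏-merges : ∀ F → Merges (eval𝕏 K F)
  eval𝕏-merges []            p q α β k = trans (antidiag-zero (λ _ _ → refl) k) (sym (select-zero (0 ≡ᵇ k)))
  eval𝕏-merges ((a , I) ∷ F) p q α β k = begin
    antidiag K (λ x y → a * M𝕏 K I _ (α Vec.++ (x ∷ y ∷ β)) + eval𝕏 K F _ (α Vec.++ (x ∷ y ∷ β))) k
      ≈⟨ antidiag-+ _ _ k ⟩
    _ ≈⟨ +-cong (trans (antidiag-* a _ k) (*-congˡ (terms-merges true I p q α β k))) (eval𝕏-merges F p q α β k) ⟩
    a * select (0 ≡ᵇ k) (M𝕏 K I _ (α Vec.++ β)) + select (0 ≡ᵇ k) (eval𝕏 K F _ (α Vec.++ β))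
      ≈⟨ +-congʳ (sym (select-* (0 ≡ᵇ k) a _)) ⟩
    _ ≈⟨ select-+ (0 ≡ᵇ k) _ _ ⟩
    select (0 ≡ᵇ k) (a * M𝕏 K I _ (α Vec.++ β) + eval𝕏 K F _ (α Vec.++ β)) ∎

  Merges-resp : ∀ {g h : Family} → (∀ n e → g n e ≈ h n e) → Merges h → Merges g
  Merges-resp g≈h merges p q α β k =
    trans (antidiag-cong (λ _ _ → g≈h _ _) k) (trans (merges p q α β k) (select-cong (0 ≡ᵇ k) (sym (g≈h _ _))))

  Merges⇒MergeCondition : ∀ (f : StablePoly K) → Merges (coeff f) → MergeCondition K f
  Merges⇒MergeCondition f merges p q α β zero    = merges p q α β zero
  Merges⇒MergeCondition f merges p q α β (suc k) = merges p q α β (suc k)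

  MergeCondition⇒Merges : ∀ (f : StablePoly K) → MergeCondition K f → Merges (coeff f)
  MergeCondition⇒Merges f merges p q α β zero    = merges p q α β zero
  MergeCondition⇒Merges f merges p q α β (suc k) = merges p q α β (suc k)

  -- Exponent lists instead of vectors, so that concatenation is associative on the nose

  atList : Family → List ℕ → Carrier
  atList g l = g (length l) (Vec.fromList l)

  atList-toList : ∀ g {n} (v : Vec ℕ n) → atList g (Vec.toList v) ≡ g n v
  atList-toList g []      = ≡.refl
  atList-toList g (x ∷ v) = atList-toList (λ n w → g (suc n) (x ∷ w)) v

  atList-++ : ∀ g (α β : List ℕ) → atList g (α ++ β) ≡ g _ (Vec.fromList α Vec.++ Vec.fromList β)
  atList-++ g α β = ≡.trans (≡.cong (atList g) (≡.sym toList-fromList-++)) (atList-toList g _)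
    where
    toList-fromList-++ : Vec.toList (Vec.fromList α Vec.++ Vec.fromList β) ≡ α ++ β
    toList-fromList-++ = ≡.trans (toList-++ (Vec.fromList α) (Vec.fromList β))
      (≡.cong₂ _++_ (toList∘fromList α) (toList∘fromList β))

  atList-stable : ∀ (f : StablePoly K) l → atList (coeff f) (l ++ 0 ∷ []) ≈ atList (coeff f) l
  atList-stable f l = trans
    (reflexive (≡.trans (≡.cong (atList (coeff f)) (≡.sym toList-∷ʳ0))
                        (atList-toList (coeff f) (Vec.fromList l Vec.∷ʳ 0))))
    (stable f (length l) (Vec.fromList l))
    where
    toList-∷ʳ0 : Vec.toList (Vec.fromList l Vec.∷ʳ 0) ≡ l ++ 0 ∷ []
    toList-∷ʳ0 = ≡.trans (toList-∷ʳ 0 (Vec.fromList l)) (≡.cong (_++ 0 ∷ []) (toList∘fromList l))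

  MergesL : (List ℕ → Carrier) → Set ℓ
  MergesL h = ∀ α β k → antidiag K (λ a b → h (α ++ a ∷ b ∷ β)) k ≈ select (0 ≡ᵇ k) (h (α ++ β))

  Merges⇒MergesL : ∀ g → Merges g → MergesL (atList g)
  Merges⇒MergesL g merges α β k =
    trans (antidiag-cong (λ a b → reflexive (atList-++ g α (a ∷ b ∷ β))) k)
      (trans (merges (length α) (length β) (Vec.fromList α) (Vec.fromList β) k)
        (select-cong (0 ≡ᵇ k) (reflexive (≡.sym (atList-++ g α β)))))

  MergesL-- : ∀ {g h : List ℕ → Carrier} → MergesL g → MergesL h → MergesL (λ l → g l - h l)
  MergesL-- g-merges h-merges α β k =
    trans (antidiag-+ _ _ k) (trans (+-cong (g-merges α β k) (trans (antidiag-neg _ k) (-‿cong (h-merges α β k))))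
      (trans (+-congˡ (sym (select-neg (0 ≡ᵇ k) _))) (select-+ (0 ≡ᵇ k) _ _)))

  -- Positions are counted from 1, so even-supported lists are exponents of monomials in x₂, x₄, ….

  data EvenSupported : List ℕ → Set where
    done  : EvenSupported []
    done0 : EvenSupported (0 ∷ [])
    pair  : ∀ y {v} → EvenSupported v → EvenSupported (0 ∷ y ∷ v)

  data EvenSupportedPairs : List ℕ → Set where
    done : EvenSupportedPairs []
    pair : ∀ y {α} → EvenSupportedPairs α → EvenSupportedPairs (0 ∷ y ∷ α)

  pairs-snoc : ∀ {α} y → EvenSupportedPairs α → EvenSupportedPairs (α ++ 0 ∷ y ∷ [])
  pairs-snoc y done       = pair y done
  pairs-snoc y (pair z α) = pair z (pairs-snoc y α)

  pairs-++ : ∀ {α v} → EvenSupportedPairs α → EvenSupported v → EvenSupported (α ++ v)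
  pairs-++ done       v = v
  pairs-++ (pair y α) v = pair y (pairs-++ α v)

  mutual
    nonzeroAtOdd : List ℕ → ℕ
    nonzeroAtOdd []          = 0
    nonzeroAtOdd (zero  ∷ v) = nonzeroAtEven v
    nonzeroAtOdd (suc _ ∷ v) = suc (nonzeroAtEven v)

    nonzeroAtEven : List ℕ → ℕ
    nonzeroAtEven []      = 0
    nonzeroAtEven (_ ∷ v) = nonzeroAtOdd v

  -- Induction on the number of nonzero odd entries, and inside it on the first such entry
  -- k+1: appending 0,0 after it and merging it with its right neighbour in degree k+1
  -- writes h(…, k+1, 0, 0, …) as minus the terms h(…, a, k+1-a, 0, …) with a ≤ k, which
  -- have a smaller first odd entry or (a = 0) one fewer nonzero odd entry.
  vanishing-on-evenSupported⇒zero : ∀ (h : List ℕ → Carrier) → MergesL h →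
    (∀ v → EvenSupported v → h v ≈ 0#) → ∀ v → h v ≈ 0#
  vanishing-on-evenSupported⇒zero h h-merges h-even v = vanishes (nonzeroAtOdd v) [] v done ℕₚ.≤-refl
    where
    h-assoc : ∀ α β γ → h (α ++ (β ++ γ)) ≡ h ((α ++ β) ++ γ)
    h-assoc α β γ = ≡.cong h (≡.sym (Listₚ.++-assoc α β γ))

    VanishesAt : ℕ → ℕ → Set ℓ
    VanishesAt n k = ∀ α w → EvenSupportedPairs α → nonzeroAtEven w ≤ n → h (α ++ suc k ∷ w) ≈ 0#

    mutual
      vanishes : ∀ n α v → EvenSupportedPairs α → nonzeroAtOdd v ≤ n → h (α ++ v) ≈ 0#
      vanishes n       α []            α-pairs _ = h-even _ (pairs-++ α-pairs done)
      vanishes n       α (0 ∷ [])      α-pairs _ = h-even _ (pairs-++ α-pairs done0)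
      vanishes n       α (0 ∷ y ∷ v)   α-pairs v≤n =
        trans (reflexive (h-assoc α (0 ∷ y ∷ []) v)) (vanishes n (α ++ 0 ∷ y ∷ []) v (pairs-snoc y α-pairs) v≤n)
      vanishes (suc n) α (suc k ∷ w)   α-pairs (s≤s w≤n) = <-rec (VanishesAt n) (vanishesAt n) k α w α-pairs w≤n

      vanishesAt : ∀ n k → (∀ {j} → j < k → VanishesAt n j) → VanishesAt n k
      vanishesAt n k smaller α w α-pairs w≤n = begin
        h (α ++ suc k ∷ w)                           ≡⟨ h-assoc α (suc k ∷ []) w ⟩
        h ((α ++ suc k ∷ []) ++ w)                   ≈⟨ h-merges (α ++ suc k ∷ []) w 0 ⟨
        h ((α ++ suc k ∷ []) ++ 0 ∷ 0 ∷ w)           ≡⟨ h-assoc α (suc k ∷ []) (0 ∷ 0 ∷ w) ⟨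
        h (α ++ suc k ∷ 0 ∷ 0 ∷ w)                   ≈⟨ antidiag-last (suc k) g lower ⟨
        antidiag K g (suc k)                         ≈⟨ h-merges α (0 ∷ w) (suc k) ⟩
        0#                                           ∎
        where
        g : ℕ → ℕ → Carrier
        g a b = h (α ++ a ∷ b ∷ 0 ∷ w)

        lower : ∀ a → a < suc k → g a (suc k ℕ.∸ a) ≈ 0#
        lower zero     _         = trans (reflexive (h-assoc α (0 ∷ suc k ∷ []) (0 ∷ w)))
          (vanishes n (α ++ 0 ∷ suc k ∷ []) (0 ∷ w) (pairs-snoc (suc k) α-pairs) w≤n)
        lower (suc a) (s≤s a<k) = smaller a<k α (k ℕ.∸ a ∷ 0 ∷ w) α-pairs w≤n

  compositionOf : List ℕ → Composition K
  compositionOf []              = []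
  compositionOf (_ ∷ [])        = []
  compositionOf (_ ∷ zero  ∷ v) = compositionOf v
  compositionOf (_ ∷ suc y ∷ v) = y ∷ compositionOf v

  evenMonomial : Composition K → List ℕ
  evenMonomial []      = []
  evenMonomial (y ∷ I) = 0 ∷ suc y ∷ evenMonomial I

  infix 4 _==_
  _==_ : List ℕ → List ℕ → Bool
  []     == []     = true
  []     == _ ∷ _  = false
  _ ∷ _  == []     = false
  x ∷ xs == y ∷ ys = (x ≡ᵇ y) ∧ (xs == ys)

  blocks-at-0 : ∀ odd (Y : Composition K → Carrier) I →
    ∑[ s ∈ blocks odd I ] select (blockSum s ≡ᵇ 0) (blockSign odd s * Y (proj₂ s)) ≈ Y I
  blocks-at-0 true  Y []       = trans (+-identityʳ _) (*-identityˡ _)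
  blocks-at-0 true  Y (x ∷ xs) = trans
    (+-congˡ (trans (reflexive (ΣL-map _ (splits K xs) _)) (ΣL-zero (splits K xs) (λ _ → refl))))
    (trans (+-identityʳ _) (*-identityˡ _))
  blocks-at-0 false Y []       = trans (+-identityʳ _) (*-identityˡ _)
  blocks-at-0 false Y (x ∷ xs) = trans (+-congˡ (+-identityʳ _)) (trans (+-identityʳ _) (*-identityˡ _))

  smallSplits-at-suc : ∀ (Y : Composition K → Carrier) x xs y →
    ∑[ s ∈ smallSplits K (x ∷ xs) ] select (blockSum s ≡ᵇ suc y) (1# * Y (proj₂ s)) ≈ select (x ≡ᵇ y) (Y xs)
  smallSplits-at-suc Y x xs y = trans (+-identityˡ _) (trans (+-identityʳ _)
    (trans (reflexive (select-≡ (suc y) _ (ℕₚ.+-identityʳ (suc x)))) (select-cong (x ≡ᵇ y) (*-identityˡ _))))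

  terms-[] : ∀ odd I → coeffOf K (terms K 0 odd I) [] ≈ select (I == []) 1#
  terms-[] odd []      = +-identityʳ 1#
  terms-[] odd (_ ∷ _) = refl

  M𝕏-evenSupported : ∀ I {v} → EvenSupported v → atList (M𝕏 K I) v ≈ select (I == compositionOf v) 1#
  M𝕏-evenSupported I done  = terms-[] true I
  M𝕏-evenSupported I done0 =
    trans (terms-∷ true 0 I 0 []) (trans (blocks-at-0 true _ I) (terms-[] false I))
  M𝕏-evenSupported I (pair y {v} v-even) =
    trans (terms-∷ true _ I 0 (y ∷ Vec.fromList v)) (trans (blocks-at-0 true _ I)
      (trans (terms-∷ false _ I y (Vec.fromList v)) (evenEntry y I)))
    where
    M𝕏-v : Composition K → Carrier
    M𝕏-v J = atList (M𝕏 K J) v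

    evenEntry : ∀ y I →
      ∑[ s ∈ smallSplits K I ] select (blockSum s ≡ᵇ y) (1# * M𝕏-v (proj₂ s))
      ≈ select (I == compositionOf (0 ∷ y ∷ v)) 1#
    evenEntry zero    I       = trans (blocks-at-0 false M𝕏-v I) (M𝕏-evenSupported I v-even)
    evenEntry (suc y) []      = +-identityʳ _
    evenEntry (suc y) (x ∷ I) = trans (smallSplits-at-suc M𝕏-v x I y)
      (trans (select-cong (x ≡ᵇ y) (M𝕏-evenSupported I v-even)) (select-select (x ≡ᵇ y) _ 1#))

  -- Merging removes the pairs 0,0 and stability the final 0.
  evenSupported-normalize : ∀ (g : List ℕ → Carrier) → MergesL g → (∀ l → g (l ++ 0 ∷ []) ≈ g l) →
    ∀ α {v} → EvenSupported v → g (α ++ v) ≈ g (α ++ evenMonomial (compositionOf v))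
  evenSupported-normalize g g-merges g-stable α done  = refl
  evenSupported-normalize g g-merges g-stable α done0 =
    trans (g-stable α) (reflexive (≡.cong g (≡.sym (Listₚ.++-identityʳ α))))
  evenSupported-normalize g g-merges g-stable α (pair zero {v} v-even) =
    trans (g-merges α v 0) (evenSupported-normalize g g-merges g-stable α v-even)
  evenSupported-normalize g g-merges g-stable α (pair (suc y) {v} v-even) =
    trans (reflexive (≡.cong g (≡.sym (Listₚ.++-assoc α (0 ∷ suc y ∷ []) v))))
      (trans (evenSupported-normalize g g-merges g-stable (α ++ 0 ∷ suc y ∷ []) v-even)
        (reflexive (≡.cong g (Listₚ.++-assoc α (0 ∷ suc y ∷ []) (evenMonomial (compositionOf v))))))

  boundedCompositions : ℕ → ℕ → List (Composition K)
  boundedCompositions B zero    = [] ∷ []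
  boundedCompositions B (suc r) = [] ∷ concatMap (λ x → map (x ∷_) (boundedCompositions B r)) (downFrom B)

  isBounded : ℕ → ℕ → Composition K → Bool
  isBounded B r       []      = true
  isBounded B zero    (_ ∷ _) = false
  isBounded B (suc r) (y ∷ J) = (y <ᵇ B) ∧ isBounded B r J

  ΣL-downFrom-select : ∀ B y (Z : ℕ → Carrier) →
    ∑[ x ∈ downFrom B ] select (x ≡ᵇ y) (Z x) ≈ select (y <ᵇ B) (Z y)
  ΣL-downFrom-select zero    y Z = refl
  ΣL-downFrom-select (suc B) y Z = trans (+-congˡ (ΣL-downFrom-select B y Z)) (last B y Z)
    where
    last : ∀ B y (Z : ℕ → Carrier) → select (B ≡ᵇ y) (Z B) + select (y <ᵇ B) (Z y) ≈ select (y <ᵇ suc B) (Z y)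
    last zero    zero    Z = +-identityʳ _
    last zero    (suc y) Z = +-identityʳ _
    last (suc B) zero    Z = +-identityˡ _
    last (suc B) (suc y) Z = last B y (λ n → Z (suc n))

  ΣL-boundedCompositions : ∀ B r (g : Composition K → Carrier) J →
    ∑[ I ∈ boundedCompositions B r ] select (I == J) (g I) ≈ select (isBounded B r J) (g J)
  ΣL-boundedCompositions B zero    g []      = +-identityʳ _
  ΣL-boundedCompositions B zero    g (y ∷ J) = +-identityʳ _
  ΣL-boundedCompositions B (suc r) g []      = trans (+-congˡ (trans (ΣL-concatMap _ (downFrom B) _)
    (ΣL-zero (downFrom B) (λ x → trans (reflexive (ΣL-map (x ∷_) (boundedCompositions B r) _))
      (ΣL-zero (boundedCompositions B r) (λ _ → refl))))))
    (+-identityʳ _)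
  ΣL-boundedCompositions B (suc r) g (y ∷ J) = begin
    0# + ΣL (concatMap (λ x → map (x ∷_) (boundedCompositions B r)) (downFrom B)) (λ I → select (I == y ∷ J) (g I))
      ≈⟨ trans (+-identityˡ _) (ΣL-concatMap _ (downFrom B) _) ⟩
    ∑[ x ∈ downFrom B ] ΣL (map (x ∷_) (boundedCompositions B r)) (λ I → select (I == y ∷ J) (g I))
      ≈⟨ ΣL-cong (downFrom B) (λ x → trans (reflexive (ΣL-map (x ∷_) (boundedCompositions B r) _)) (headEntry x)) ⟩
    ∑[ x ∈ downFrom B ] select (x ≡ᵇ y) (select (isBounded B r J) (g (x ∷ J)))
      ≈⟨ ΣL-downFrom-select B y _ ⟩
    select (y <ᵇ B) (select (isBounded B r J) (g (y ∷ J)))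
      ≈⟨ select-select (y <ᵇ B) _ _ ⟩
    select (isBounded B (suc r) (y ∷ J)) (g (y ∷ J)) ∎
    where
    headEntry : ∀ x → ∑[ I ∈ boundedCompositions B r ] select ((x ≡ᵇ y) ∧ (I == J)) (g (x ∷ I))
                      ≈ select (x ≡ᵇ y) (select (isBounded B r J) (g (x ∷ J)))
    headEntry x = begin
      ∑[ I ∈ boundedCompositions B r ] select ((x ≡ᵇ y) ∧ (I == J)) (g (x ∷ I))
        ≈⟨ ΣL-cong (boundedCompositions B r) (λ I → sym (select-select (x ≡ᵇ y) (I == J) _)) ⟩
      ∑[ I ∈ boundedCompositions B r ] select (x ≡ᵇ y) (select (I == J) (g (x ∷ I)))
        ≈⟨ select-ΣL (x ≡ᵇ y) (boundedCompositions B r) _ ⟨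
      select (x ≡ᵇ y) (∑[ I ∈ boundedCompositions B r ] select (I == J) (g (x ∷ I)))
        ≈⟨ select-cong (x ≡ᵇ y) (ΣL-boundedCompositions B r (λ I → g (x ∷ I)) J) ⟩
      select (x ≡ᵇ y) (select (isBounded B r J) (g (x ∷ J))) ∎

  <ᵇ-false⇒≥ : ∀ y B → (y <ᵇ B) ≡ false → B ≤ y
  <ᵇ-false⇒≥ y       zero    _  = z≤n
  <ᵇ-false⇒≥ zero    (suc B) ()
  <ᵇ-false⇒≥ (suc y) (suc B) eq = s≤s (<ᵇ-false⇒≥ y B eq)

  unbounded⇒large : ∀ D r J → r ≤ D → isBounded (suc D) r J ≡ false → r < partSum K J
  unbounded⇒large D zero    (y ∷ J) r≤D _ = s≤s z≤n
  unbounded⇒large D (suc r) (y ∷ J) r≤D unbounded with y <ᵇ suc D in y<ᵇ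
  ... | false = s≤s (ℕₚ.≤-trans r≤D (ℕₚ.≤-trans (ℕₚ.<⇒≤ (<ᵇ-false⇒≥ y (suc D) y<ᵇ)) (ℕₚ.m≤m+n y (partSum K J))))
  ... | true  = s≤s (ℕₚ.≤-trans (unbounded⇒large D r J (ℕₚ.≤-trans (ℕₚ.n≤1+n r) r≤D) unbounded)
                                (ℕₚ.m≤n+m (partSum K J) y))

  sum-evenMonomial : ∀ J → Vec.sum (Vec.fromList (evenMonomial J)) ≡ partSum K J
  sum-evenMonomial []      = ≡.refl
  sum-evenMonomial (y ∷ J) = ≡.cong (suc y ℕ.+_) (sum-evenMonomial J)

  -- Only compositions of size at most the degree bound contribute, and such a composition
  -- has at most that many parts, each below the bound plus one.

  preimage : StablePoly K → QSymElt K
  preimage f = map (λ I → atList (coeff f) (evenMonomial I) , I)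
                   (boundedCompositions (suc (degBound f)) (degBound f))

  eval𝕏-map : ∀ (a : Composition K → Carrier) L n e →
    eval𝕏 K (map (λ I → a I , I) L) n e ≈ ∑[ I ∈ L ] a I * M𝕏 K I n e
  eval𝕏-map a []      n e = refl
  eval𝕏-map a (I ∷ L) n e = +-congˡ (eval𝕏-map a L n e)

  preimage-evenSupported : ∀ f {v} → EvenSupported v →
    atList (eval𝕏 K (preimage f)) v ≈ atList (coeff f) (evenMonomial (compositionOf v))
  preimage-evenSupported f {v} v-even = begin
    atList (eval𝕏 K (preimage f)) v
      ≈⟨ eval𝕏-map a (boundedCompositions (suc D) D) (length v) (Vec.fromList v) ⟩
    ∑[ I ∈ boundedCompositions (suc D) D ] a I * atList (M𝕏 K I) v
      ≈⟨ ΣL-cong (boundedCompositions (suc D) D) (λ I →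
           trans (*-congˡ (M𝕏-evenSupported I v-even)) (*-select-1# _ _)) ⟩
    ∑[ I ∈ boundedCompositions (suc D) D ] select (I == compositionOf v) (a I)
      ≈⟨ ΣL-boundedCompositions (suc D) D a (compositionOf v) ⟩
    select (isBounded (suc D) D (compositionOf v)) (a (compositionOf v))
      ≈⟨ unbounded-vanishes (compositionOf v) ⟩
    a (compositionOf v) ∎
    where
    D : ℕ
    D = degBound f

    a : Composition K → Carrier
    a I = atList (coeff f) (evenMonomial I)

    unbounded-vanishes : ∀ J → select (isBounded (suc D) D J) (a J) ≈ a J
    unbounded-vanishes J with isBounded (suc D) D J in unbounded
    ... | true  = refl
    ... | false = sym (bounded f _ (Vec.fromList (evenMonomial J))
                   (≡.subst (D <_) (≡.sym (sum-evenMonomial J)) (unbounded⇒large D D J ℕₚ.≤-refl unbounded)))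

  MergeCondition⇒InImage𝕏 : ∀ f → MergeCondition K f → InImage𝕏 K f
  MergeCondition⇒InImage𝕏 f merges = preimage f , λ n e → begin
    coeff f n e                            ≡⟨ atList-toList (coeff f) e ⟨
    atList (coeff f) (Vec.toList e)        ≈⟨ x∙y⁻¹≈ε⇒x≈y _ _ (difference-zero (Vec.toList e)) ⟩
    atList (eval𝕏 K F) (Vec.toList e)      ≡⟨ atList-toList (eval𝕏 K F) e ⟩
    eval𝕏 K F n e                          ∎
    where
    F : QSymElt K
    F = preimage f

    f-merges : MergesL (atList (coeff f))
    f-merges = Merges⇒MergesL (coeff f) (MergeCondition⇒Merges f merges)

    difference : List ℕ → Carrier
    difference l = atList (coeff f) l - atList (eval𝕏 K F) l

    difference-merges : MergesL difference
    difference-merges =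
      MergesL-- {atList (coeff f)} {atList (eval𝕏 K F)} f-merges (Merges⇒MergesL (eval𝕏 K F) (eval𝕏-merges F))

    difference-even : ∀ v → EvenSupported v → difference v ≈ 0#
    difference-even v v-even = begin
      difference v ≈⟨ +-cong (evenSupported-normalize _ f-merges (atList-stable f) [] v-even)
                             (-‿cong (preimage-evenSupported f v-even)) ⟩
      atList (coeff f) (evenMonomial (compositionOf v)) - atList (coeff f) (evenMonomial (compositionOf v))
                   ≈⟨ -‿inverseʳ _ ⟩
      0# ∎

    difference-zero : ∀ v → difference v ≈ 0#
    difference-zero = vanishing-on-evenSupported⇒zero difference difference-merges difference-even

  InImage𝕏⇒MergeCondition : ∀ f → InImage𝕏 K f → MergeCondition K f
  InImage𝕏⇒MergeCondition f (F , f≈F) = Merges⇒MergeCondition f (Merges-resp f≈F (eval𝕏-merges F))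

theorem3p1 : ∀ {c ℓ} (K : CommutativeRing c ℓ) → IsChar0Field K →
    (f : StablePoly K) → (MergeCondition K f ⇔ InImage𝕏 K f)
theorem3p1 K _ f = mk⇔ (MergeCondition⇒InImage𝕏 K f) (InImage𝕏⇒MergeCondition K f)
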